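{- Let $Q$ be a Schröder path and let $Q=F_1F_2\cdots F_k$ be its factorization into $k$ factors. For $1\le i\le k$ let $a_i$ and $d_i$ be the number of ascents and of descents of $F_i$, respectively. Then the number of Schröder paths covered by $Q$ in the Schröder pattern poset is $$\sum_{1\le i\le j\le k} d_i a_j \;-\; p(Q)\;-\;v(Q)\;+\;h(Q).$$
   Context: Schröder paths and the pattern order: - A Schröder path is a finite word over the alphabet $\{U,D,H_2\}$, interpreted as a lattice path starting at $(0,0)$ with steps $U=(1,1)$, $D=(1,-1)$, $H_2=(2,0)$. - It is required to end on the $x$-axis and never go below it. Equivalently, it has equally many $U$'s and $D$'s, and every prefix has at least as many $U$'s as $D$'s. The empty word is a Schröder path. - The semilength of a Schröder path is half its final abscissa, i.e. (number of $U$ steps) + (number of $H_2$ steps). - For Schröder paths $P,Q$ we write $P\le Q$ if $P$ occurs as a (not necessarily contiguous) subword of $Q$. This gives the Schröder pattern poset, ranked by semilength. - $Q$ covers $P$ if $P\le Q$ and $\mathrm{semilength}(P)=\mathrm{semilength}(Q)-1$. Factors: Let $p_0=(0,0),p_1,\dots,p_k$ be the successive vertices of $Q$ (endpoints of prefixes) lying on the $x$-axis. The factor $F_i$ is the subpath from $p_{i-1}$ to $p_i$; each factor is either a single $H_2$ or of the form $URD$ with $R$ a Schröder path. Ascents, descents, flats and counts: - An ascent (resp. descent) is a maximal run of consecutive $U$ (resp. $D$) steps. - A flat is a maximal run of consecutive $H_2$ steps. - $p(Q)$ and $v(Q)$ denote the numbers of occurrences in $Q$ of the consecutive factors $UDU$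 and $DUD$, respectively. - $h(Q)$ denotes the number of flats of $Q$. -}

module Defs where

open import Data.Nat using (ℕ; zero; suc; _+_; _*_; _∸_)
open import Data.List using (List; []; _∷_; reverse; map)
open import Data.Nat.ListAction using (sum)
open import Data.Maybe using (Maybe; just; nothing)
open import Data.Bool using (Bool; true; false; if_then_else_)
open import Relation.Nullary using (Dec; yes; no)
open import Relation.Nullary.Decidable using (⌊_⌋)
open import Relation.Binary.PropositionalEquality using (_≡_; refl)
import Data.List.Relation.Binary.Sublist.Propositional as Sub

-- Steps: U = (1,1), D = (1,-1), H = H₂ = (2,0)
data Step : Set where
  U D H : Step

_≟ₛ_ : (x y : Step) → Dec (x ≡ y)
U ≟ₛ U = yes refl
U ≟ₛ D = no λ ()
U ≟ₛ H = no λ ()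
D ≟ₛ U = no λ ()
D ≟ₛ D = yes refl
D ≟ₛ H = no λ ()
H ≟ₛ U = no λ ()
H ≟ₛ D = no λ ()
H ≟ₛ H = yes refl

Word : Set
Word = List Step

-- walk from height h; nothing if the path goes below the x-axis
walk : ℕ → Word → Maybe ℕ
walk h [] = just h
walk h (U ∷ w) = walk (suc h) w
walk zero (D ∷ w) = nothing
walk (suc h) (D ∷ w) = walk h w
walk h (H ∷ w) = walk h w

-- Schröder path: never below the axis, ends on the axis
IsSchroder : Word → Set
IsSchroder w = walk 0 w ≡ just 0

count : Step → Word → ℕ
count s [] = 0
count s (x ∷ w) = (if ⌊ x ≟ₛ s ⌋ then 1 else 0) + count s w

semilength : Word → ℕ
semilength w = count U w + count H w

_≼_ : Word → Word → Set
P ≼ Q = P Sub.⊆ Q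

-- number of maximal runs of the step s (ascents for U, descents for D, flats for H)
-- runsFrom b s w : b says whether the preceding letter was s
runsFrom : Bool → Step → Word → ℕ
runsFrom b s [] = 0
runsFrom b s (x ∷ w) with ⌊ x ≟ₛ s ⌋
... | true  = (if b then 0 else 1) + runsFrom true s w
... | false = runsFrom false s w

runs : Step → Word → ℕ
runs s w = runsFrom false s w

ascents descents flats : Word → ℕ
ascents  = runs U
descents = runs D
flats    = runs H

isPrefix : Word → Word → Bool
isPrefix [] w = true
isPrefix (x ∷ p) [] = false
isPrefix (x ∷ p) (y ∷ w) = if ⌊ x ≟ₛ y ⌋ then isPrefix p w else false

-- number of occurrences of pat as a consecutive factor (overlaps allowed)
occurrences : Word → Word → ℕ
occurrences pat [] = if isPrefix pat [] then 1 else 0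
occurrences pat (x ∷ w) = (if isPrefix pat (x ∷ w) then 1 else 0) + occurrences pat w

pk : Word → ℕ
pk Q = occurrences (U ∷ D ∷ U ∷ []) Q

vl : Word → ℕ
vl Q = occurrences (D ∷ U ∷ D ∷ []) Q

hf : Word → ℕ
hf Q = flats Q

-- factorization: cut the path at each return to the x-axis.
-- factorsFrom h cur w : h = current height, cur = current factor (reversed)
factorsFrom : ℕ → Word → Word → List Word
factorsFrom h cur [] = []
factorsFrom h cur (s ∷ w) with step s h
  where
  step : Step → ℕ → ℕ
  step U h = suc h
  step D h = h ∸ 1
  step H h = h
... | zero  = reverse (s ∷ cur) ∷ factorsFrom zero [] w
... | suc h' = factorsFrom (suc h') (s ∷ cur) w

factors : Word → List Word
factors Q = factorsFrom 0 [] Q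

-- Σ_{1 ≤ i ≤ j ≤ k} d_i a_j for the factor list F_1 … F_k
-- = Σ_i d_i · (a_i + a_{i+1} + … + a_k)
sumDA : List Word → ℕ
sumDA [] = 0
sumDA (F ∷ Fs) = descents F * sum (map ascents (F ∷ Fs)) + sumDA Fs

module Submission where

-- A lower cover of Q is obtained by deleting either one H₂ or one U and one D. Deleting a
-- letter only where it ends its run lists every cover once, so the H₂-deletions give one cover
-- per flat. Deleting a D and a later U is always allowed, whereas deleting a U and a later D
-- stays above the axis only inside one factor; so the deletable pairs of runs are exactly
-- (descent of F_i, ascent of F_j) with i ≤ j, Σ d_i a_j of them. Two such pairs yield the same
-- path precisely around an occurrence of UDU or DUD, and the enumeration skips exactly these.

open import Defs
open import Data.Bool using (Bool; true; false; not; _∧_; if_then_else_)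
import Data.Bool as Bool
open import Data.Empty using (⊥-elim)
open import Data.Integer using (ℤ; +_; _+_; _-_)
import Data.Integer.Properties as ℤ
import Data.Integer.Tactic.RingSolver as ℤ-Solver
open import Data.List using (List; []; _∷_; _++_; map; length; reverse; filter)
open import Data.List.Properties
  using (length-++; length-map; filter-++; filter-all; filter-none; unfold-reverse; ++-assoc;
         ∷-injectiveʳ)
open import Data.List.Membership.Propositional using (_∈_)
open import Data.List.Membership.Propositional.Properties
  using (∈-++⁺ˡ; ∈-++⁺ʳ; ∈-++⁻; ∈-map⁺; ∈-map⁻; ∈-filter⁺; ∈-filter⁻)
open import Data.List.Relation.Binary.Disjoint.Propositional using (Disjoint)
open import Data.List.Relation.Binary.Sublist.Propositional using (_⊆_; []; _∷_; _∷ʳ_; ⊆-refl)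
open import Data.List.Relation.Unary.All using ([]; tabulate)
open import Data.List.Relation.Unary.AllPairs using ([]; _∷_)
open import Data.List.Relation.Unary.Any using (here)
open import Data.List.Relation.Unary.Unique.Propositional using (Unique)
import Data.List.Relation.Unary.Unique.Propositional.Properties as Unique
open import Data.Maybe using (Maybe; just; nothing; maybe′; is-just)
open import Data.Nat using (ℕ; zero; suc; _≤_; _<_; z≤n; s≤s)
import Data.Nat as ℕ
open import Data.Nat.ListAction using (sum)
open import Data.Nat.Properties
open import Algebra.Properties.CommutativeSemigroup +-commutativeSemigroup
  using (xy∙z≈xz∙y; x∙yz≈y∙xz)
open import Data.Nat.Tactic.RingSolver using (solve-∀)
open import Data.Product using (Σ; ∃-syntax; _×_; _,_; proj₁; proj₂)
open import Data.Sum using (_⊎_; inj₁; inj₂)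
open import Function.Base using (case_of_)
open import Function.Bundles using (_⇔_; mk⇔)
open import Relation.Nullary using (Dec; yes; no)
open import Relation.Nullary.Decidable using (⌊_⌋)
open import Relation.Binary.PropositionalEquality

𝟙 : Bool → ℕ
𝟙 b = if b then 1 else 0

≟ₛ-refl : ∀ s → ⌊ s ≟ₛ s ⌋ ≡ true
≟ₛ-refl U = refl
≟ₛ-refl D = refl
≟ₛ-refl H = refl

≟ₛ-≢ : ∀ {x s} → x ≢ s → ⌊ x ≟ₛ s ⌋ ≡ false
≟ₛ-≢ {x} {s} x≢s with x ≟ₛ s
... | yes x≡s = ⊥-elim (x≢s x≡s)
... | no _ = refl

startsWith : Step → Word → Bool
startsWith s [] = false
startsWith s (x ∷ _) = ⌊ x ≟ₛ s ⌋

startsWith-∷ : ∀ s w → startsWith s (s ∷ w) ≡ true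
startsWith-∷ s w = ≟ₛ-refl s

startsWith-view : ∀ s w → startsWith s w ≡ false ⊎ ∃[ w′ ] w ≡ s ∷ w′
startsWith-view s [] = inj₁ refl
startsWith-view s (x ∷ w) with x ≟ₛ s
... | yes refl = inj₂ (w , refl)
... | no _ = inj₁ refl

isPrefix-singleton : ∀ s w → isPrefix (s ∷ []) w ≡ startsWith s w
isPrefix-singleton s [] = refl
isPrefix-singleton s (x ∷ w) with s ≟ₛ x
... | yes refl = sym (≟ₛ-refl s)
... | no s≢x = sym (≟ₛ-≢ (≢-sym s≢x))

runs-∷-self : ∀ s w → runs s (s ∷ w) ≡ 𝟙 (not (startsWith s w)) ℕ.+ runs s w
runs-∷-self U [] = refl
runs-∷-self U (U ∷ w) = refl
runs-∷-self U (D ∷ w) = refl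
runs-∷-self U (H ∷ w) = refl
runs-∷-self D [] = refl
runs-∷-self D (U ∷ w) = refl
runs-∷-self D (D ∷ w) = refl
runs-∷-self D (H ∷ w) = refl
runs-∷-self H [] = refl
runs-∷-self H (U ∷ w) = refl
runs-∷-self H (D ∷ w) = refl
runs-∷-self H (H ∷ w) = refl

count-∷-self : ∀ s w → count s (s ∷ w) ≡ suc (count s w)
count-∷-self s w rewrite ≟ₛ-refl s = refl

heightAfter : Step → ℕ → Maybe ℕ
heightAfter U h = just (suc h)
heightAfter D zero = nothing
heightAfter D (suc h) = just h
heightAfter H h = just h

walk-∷ : ∀ x h w →
  walk h (x ∷ w) ≡ maybe′ (λ h′ → walk h′ w) nothing (heightAfter x h)
walk-∷ U h w = refl
walk-∷ D zero w = refl
walk-∷ D (suc h) w = refl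
walk-∷ H h w = refl

walk-∷⁻ : ∀ {x h w k} → walk h (x ∷ w) ≡ just k →
  ∃[ h′ ] heightAfter x h ≡ just h′ × walk h′ w ≡ just k
walk-∷⁻ {x} {h} {w} eq with heightAfter x h | walk-∷ x h w
... | just h′ | walk≡ = h′ , refl , trans (sym walk≡) eq
... | nothing | walk≡ with () ← trans (sym walk≡) eq

walk-∷⁺ : ∀ {x h h′ w} → heightAfter x h ≡ just h′ → walk h (x ∷ w) ≡ walk h′ w
walk-∷⁺ {x} {h} {h′} {w} eq =
  trans (walk-∷ x h w) (cong (maybe′ (λ h″ → walk h″ w) nothing) eq)

Walkable : ℕ → Word → Set
Walkable h w = ∃[ k ] walk h w ≡ just k

walk-height : ∀ {h w k} → walk h w ≡ just k → h ℕ.+ count U w ≡ k ℕ.+ count D w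
walk-height {h} {[]} refl = refl
walk-height {h} {U ∷ w} eq = trans (+-suc h _) (walk-height {suc h} {w} eq)
walk-height {h} {H ∷ w} eq = walk-height {h} {w} eq
walk-height {suc h} {D ∷ w} {k} eq = trans (cong suc (walk-height {h} {w} eq)) (sym (+-suc k _))

walk-zero-startsWith-D : ∀ {w k} → walk 0 w ≡ just k → startsWith D w ≡ false
walk-zero-startsWith-D {[]} _ = refl
walk-zero-startsWith-D {U ∷ w} _ = refl
walk-zero-startsWith-D {H ∷ w} _ = refl

-- Deletions and lower covers

data Deletion (s : Step) : Word → Word → Set where
  here  : ∀ {w} → Deletion s (s ∷ w) w
  there : ∀ x {w e} → Deletion s w e → Deletion s (x ∷ w) (x ∷ e)

data UDDeletion : Word → Word → Set where
  hereU : ∀ {w e} → Deletion D w e → UDDeletion (U ∷ w) e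
  hereD : ∀ {w e} → Deletion U w e → UDDeletion (D ∷ w) e
  there : ∀ x {w e} → UDDeletion w e → UDDeletion (x ∷ w) (x ∷ e)

Deletion⇒⊆ : ∀ {s w e} → Deletion s w e → e ⊆ w
Deletion⇒⊆ here = _ ∷ʳ ⊆-refl
Deletion⇒⊆ (there x d) = refl ∷ Deletion⇒⊆ d

UDDeletion⇒⊆ : ∀ {w e} → UDDeletion w e → e ⊆ w
UDDeletion⇒⊆ (hereU d) = U ∷ʳ Deletion⇒⊆ d
UDDeletion⇒⊆ (hereD d) = D ∷ʳ Deletion⇒⊆ d
UDDeletion⇒⊆ (there x d) = refl ∷ UDDeletion⇒⊆ d

count-Deletion : ∀ {s w e} → Deletion s w e →
  ∀ t → count t w ≡ 𝟙 ⌊ s ≟ₛ t ⌋ ℕ.+ count t e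
count-Deletion here t = refl
count-Deletion {s} (there x d) t =
  trans (cong (𝟙 ⌊ x ≟ₛ t ⌋ ℕ.+_) (count-Deletion d t))
        (x∙yz≈y∙xz (𝟙 ⌊ x ≟ₛ t ⌋) (𝟙 ⌊ s ≟ₛ t ⌋) _)

count-UDDeletion : ∀ {w e} → UDDeletion w e →
  ∀ t → count t w ≡ 𝟙 ⌊ U ≟ₛ t ⌋ ℕ.+ (𝟙 ⌊ D ≟ₛ t ⌋ ℕ.+ count t e)
count-UDDeletion (hereU d) t = cong (𝟙 ⌊ U ≟ₛ t ⌋ ℕ.+_) (count-Deletion d t)
count-UDDeletion (hereD d) t =
  trans (cong (𝟙 ⌊ D ≟ₛ t ⌋ ℕ.+_) (count-Deletion d t))
        (x∙yz≈y∙xz (𝟙 ⌊ D ≟ₛ t ⌋) (𝟙 ⌊ U ≟ₛ t ⌋) _)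
count-UDDeletion (there x d) t =
  trans (cong (𝟙 ⌊ x ≟ₛ t ⌋ ℕ.+_) (count-UDDeletion d t))
        (rotate (𝟙 ⌊ x ≟ₛ t ⌋) (𝟙 ⌊ U ≟ₛ t ⌋) (𝟙 ⌊ D ≟ₛ t ⌋) _)
  where
  rotate : ∀ x u d c → x ℕ.+ (u ℕ.+ (d ℕ.+ c)) ≡ u ℕ.+ (d ℕ.+ (x ℕ.+ c))
  rotate = solve-∀

count-mono : ∀ t {e w} → e ⊆ w → count t e ≤ count t w
count-mono t [] = z≤n
count-mono t (y ∷ʳ p) = ≤-trans (count-mono t p) (m≤n+m _ _)
count-mono t (_∷_ {x = x} refl p) = +-monoʳ-≤ (𝟙 ⌊ x ≟ₛ t ⌋) (count-mono t p)

count-skipped : ∀ y {e w} → e ⊆ w → count y e < count y (y ∷ w)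
count-skipped y {w = w} p rewrite count-∷-self y w = s≤s (count-mono y p)

⊆-counts⇒≡ : ∀ {e w} → e ⊆ w → (∀ t → count t w ≡ count t e) → e ≡ w
⊆-counts⇒≡ [] _ = refl
⊆-counts⇒≡ (y ∷ʳ p) counts = ⊥-elim (<-irrefl (sym (counts y)) (count-skipped y p))
⊆-counts⇒≡ (_∷_ {x = x} refl p) counts =
  cong (x ∷_) (⊆-counts⇒≡ p λ t → +-cancelˡ-≡ (𝟙 ⌊ x ≟ₛ t ⌋) _ _ (counts t))

⊆-counts⇒Deletion : ∀ {s e w} → e ⊆ w →
  (∀ t → count t w ≡ 𝟙 ⌊ s ≟ₛ t ⌋ ℕ.+ count t e) → Deletion s w e
⊆-counts⇒Deletion {s} [] counts
  with () ← trans (counts s) (cong (λ b → 𝟙 b ℕ.+ 0) (≟ₛ-refl s))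
⊆-counts⇒Deletion {s} (y ∷ʳ p) counts with y ≟ₛ s
... | yes refl
  rewrite ⊆-counts⇒≡ p (λ t → +-cancelˡ-≡ (𝟙 ⌊ y ≟ₛ t ⌋) _ _ (counts t)) = here
... | no y≢s =
  ⊥-elim (<-irrefl (sym (trans (counts y) (cong (λ b → 𝟙 b ℕ.+ _) (≟ₛ-≢ (≢-sym y≢s)))))
                   (count-skipped y p))
⊆-counts⇒Deletion {s} (_∷_ {x = x} refl p) counts =
  there x (⊆-counts⇒Deletion p λ t →
    +-cancelˡ-≡ (𝟙 ⌊ x ≟ₛ t ⌋) _ _
      (trans (counts t) (x∙yz≈y∙xz (𝟙 ⌊ s ≟ₛ t ⌋) (𝟙 ⌊ x ≟ₛ t ⌋) _)))

⊆-counts⇒UDDeletion : ∀ {e w} → e ⊆ w →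
  (∀ t → count t w ≡ 𝟙 ⌊ U ≟ₛ t ⌋ ℕ.+ (𝟙 ⌊ D ≟ₛ t ⌋ ℕ.+ count t e)) →
  UDDeletion w e
⊆-counts⇒UDDeletion [] counts with () ← counts U
⊆-counts⇒UDDeletion (U ∷ʳ p) counts =
  hereU (⊆-counts⇒Deletion p λ t → +-cancelˡ-≡ (𝟙 ⌊ U ≟ₛ t ⌋) _ _ (counts t))
⊆-counts⇒UDDeletion (D ∷ʳ p) counts =
  hereD (⊆-counts⇒Deletion p λ t →
    +-cancelˡ-≡ (𝟙 ⌊ D ≟ₛ t ⌋) _ _
      (trans (counts t) (x∙yz≈y∙xz (𝟙 ⌊ U ≟ₛ t ⌋) (𝟙 ⌊ D ≟ₛ t ⌋) _)))
⊆-counts⇒UDDeletion (H ∷ʳ p) counts = ⊥-elim (<-irrefl (sym (counts H)) (count-skipped H p))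
⊆-counts⇒UDDeletion (_∷_ {x = x} refl p) counts =
  there x (⊆-counts⇒UDDeletion p λ t →
    +-cancelˡ-≡ (𝟙 ⌊ x ≟ₛ t ⌋) _ _
      (trans (counts t) (rotate (𝟙 ⌊ U ≟ₛ t ⌋) (𝟙 ⌊ D ≟ₛ t ⌋) (𝟙 ⌊ x ≟ₛ t ⌋) _)))
  where
  rotate : ∀ u d x c → u ℕ.+ (d ℕ.+ (x ℕ.+ c)) ≡ x ℕ.+ (u ℕ.+ (d ℕ.+ c))
  rotate = solve-∀

_⋖_ : Word → Word → Set
P ⋖ Q = IsSchroder P × P ≼ Q × suc (semilength P) ≡ semilength Q

IsSchroder⇒balanced : ∀ w → IsSchroder w → count U w ≡ count D w
IsSchroder⇒balanced w = walk-height {0} {w}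

walk-balanced⇒IsSchroder : ∀ w {k} → walk 0 w ≡ just k → count U w ≡ count D w →
  IsSchroder w
walk-balanced⇒IsSchroder w {k} walk≡ bal =
  subst (λ j → walk 0 w ≡ just j) k≡0 walk≡
  where
  k≡0 : k ≡ 0
  k≡0 = +-cancelʳ-≡ (count D w) k 0 (trans (sym (walk-height {0} {w} walk≡)) bal)

Deletion-H⇒⋖ : ∀ {P Q} → IsSchroder Q → Deletion H Q P → Walkable 0 P → P ⋖ Q
Deletion-H⇒⋖ {P} {Q} sQ d (_ , walk≡) =
  walk-balanced⇒IsSchroder P walk≡
    (trans (sym (counts U)) (trans (IsSchroder⇒balanced Q sQ) (counts D))) ,
  Deletion⇒⊆ d ,
  sym (trans (cong₂ ℕ._+_ (counts U) (counts H)) (+-suc (count U P) (count H P)))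
  where counts = count-Deletion d

UDDeletion⇒⋖ : ∀ {P Q} → IsSchroder Q → UDDeletion Q P → Walkable 0 P → P ⋖ Q
UDDeletion⇒⋖ {P} {Q} sQ d (_ , walk≡) =
  walk-balanced⇒IsSchroder P walk≡
    (suc-injective (trans (sym (counts U)) (trans (IsSchroder⇒balanced Q sQ) (counts D)))) ,
  UDDeletion⇒⊆ d ,
  sym (cong₂ ℕ._+_ (counts U) (counts H))
  where counts = count-UDDeletion d

⋖⇒deletion : ∀ {P Q} → IsSchroder Q → P ⋖ Q → Deletion H Q P ⊎ UDDeletion Q P
⋖⇒deletion {P} {Q} sQ (sP , P⊆Q , sl) with m≤n⇒m<n∨m≡n (count-mono H P⊆Q)
... | inj₂ hP≡hQ = inj₂ (⊆-counts⇒UDDeletion P⊆Q counts)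
  where
  uQ≡1+uP : count U Q ≡ suc (count U P)
  uQ≡1+uP = sym (+-cancelʳ-≡ (count H Q) _ _
              (subst (λ h → suc (count U P ℕ.+ h) ≡ semilength Q) hP≡hQ sl))
  counts : ∀ t → count t Q ≡ 𝟙 ⌊ U ≟ₛ t ⌋ ℕ.+ (𝟙 ⌊ D ≟ₛ t ⌋ ℕ.+ count t P)
  counts U = uQ≡1+uP
  counts D = trans (sym (IsSchroder⇒balanced Q sQ))
                   (trans uQ≡1+uP (cong suc (IsSchroder⇒balanced P sP)))
  counts H = sym hP≡hQ
... | inj₁ hP<hQ = inj₁ (⊆-counts⇒Deletion P⊆Q counts)
  where
  uQ≤uP : count U Q ≤ count U P
  uQ≤uP = +-cancelʳ-≤ (count H Q) _ _ (subst (_≤ count U P ℕ.+ count H Q)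
            (trans (+-suc (count U P) (count H P)) sl) (+-monoʳ-≤ (count U P) hP<hQ))
  uP≡uQ : count U P ≡ count U Q
  uP≡uQ = ≤-antisym (count-mono U P⊆Q) uQ≤uP
  counts : ∀ t → count t Q ≡ 𝟙 ⌊ H ≟ₛ t ⌋ ℕ.+ count t P
  counts U = sym uP≡uQ
  counts D = trans (sym (IsSchroder⇒balanced Q sQ)) (trans (sym uP≡uQ) (IsSchroder⇒balanced P sP))
  counts H = sym (+-cancelˡ-≡ (count U Q) _ _
    (trans (trans (+-suc (count U Q) (count H P))
                  (cong (λ u → suc (u ℕ.+ count H P)) (sym uP≡uQ))) sl))

-- Enumerating deletions without repetition

prepend : Step → ℕ → (ℕ → List Word) → List Word
prepend x h F = maybe′ (λ h′ → map (x ∷_) (F h′)) [] (heightAfter x h)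

∈-prepend⁻ : ∀ {x h F e} → e ∈ prepend x h F →
  ∃[ h′ ] ∃[ e′ ] heightAfter x h ≡ just h′ × e ≡ x ∷ e′ × e′ ∈ F h′
∈-prepend⁻ {x} {h} m with heightAfter x h
... | just h′ with ∈-map⁻ (x ∷_) m
...   | e′ , m′ , refl = h′ , e′ , refl , refl , m′

∈-prepend⁺ : ∀ {x h h′ F e} → heightAfter x h ≡ just h′ → e ∈ F h′ →
  x ∷ e ∈ prepend x h F
∈-prepend⁺ {x} after≡ m rewrite after≡ = ∈-map⁺ (x ∷_) m

length-prepend : ∀ {x h h′} F → heightAfter x h ≡ just h′ →
  length (prepend x h F) ≡ length (F h′)
length-prepend {x} F after≡ rewrite after≡ = length-map (x ∷_) (F _)

prepend-unique : ∀ {x h F} → (∀ h′ → Unique (F h′)) → Unique (prepend x h F)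
prepend-unique {x} {h} u with heightAfter x h
... | just h′ = Unique.map⁺ ∷-injectiveʳ (u h′)
... | nothing = []

startsWith-prepend : ∀ {x h F e} → e ∈ prepend x h F → startsWith x e ≡ true
startsWith-prepend {x} {h} {F} m with ∈-prepend⁻ {x} {h} {F} m
... | _ , e′ , _ , refl , _ = startsWith-∷ x e′

notStartsWith-prepend : ∀ {x h F s e} → x ≢ s → e ∈ prepend x h F → startsWith s e ≡ false
notStartsWith-prepend {x} {h} {F} x≢s m with ∈-prepend⁻ {x} {h} {F} m
... | _ , e′ , _ , refl , _ = ≟ₛ-≢ x≢s

disjoint-prepend : ∀ {x h F} {A : List Word} → (∀ {e} → e ∈ A → startsWith x e ≡ false) →
  Disjoint A (prepend x h F)
disjoint-prepend {x} {h} {F} notStart (m , m′)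
  with () ← trans (sym (startsWith-prepend {x} {h} {F} m′)) (notStart m)

-- Deleting only the last letter of a run produces each deletion once.
deleteHere : Step → ℕ → Step → Word → List Word
deleteHere s h x w =
  if ⌊ x ≟ₛ s ⌋ ∧ is-just (walk h w) ∧ not (startsWith s w) then w ∷ [] else []

deletions : Step → ℕ → Word → List Word
deletions s h [] = []
deletions s h (x ∷ w) = deleteHere s h x w ++ prepend x h (λ h′ → deletions s h′ w)

∈-deleteHere⁻ : ∀ {s h x w e} → e ∈ deleteHere s h x w →
  x ≡ s × e ≡ w × Walkable h w × startsWith s w ≡ false
∈-deleteHere⁻ {s} {h} {x} {w} m with x ≟ₛ s | walk h w | startsWith s w
∈-deleteHere⁻ (here refl) | yes refl | just k | false = refl , refl , (k , refl) , refl

∈-deleteHere⁺ : ∀ {s h w} → Walkable h w → startsWith s w ≡ false →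
  w ∈ deleteHere s h s w
∈-deleteHere⁺ {s} (k , walk≡) notStart rewrite ≟ₛ-refl s | walk≡ | notStart = here refl

deleteHere-unique : ∀ s h x w → Unique (deleteHere s h x w)
deleteHere-unique s h x w with ⌊ x ≟ₛ s ⌋ ∧ is-just (walk h w) ∧ not (startsWith s w)
... | true = [] ∷ []
... | false = []

deletions-sound : ∀ {s h} w {e} → e ∈ deletions s h w → Deletion s w e × Walkable h e
deletions-sound {s} {h} (x ∷ w) m with ∈-++⁻ (deleteHere s h x w) m
... | inj₁ m₁ with ∈-deleteHere⁻ {s} {h} {x} {w} m₁
...   | refl , refl , walkable , _ = here , walkable
deletions-sound {s} {h} (x ∷ w) m | inj₂ m₂ with ∈-prepend⁻ {x} {h} m₂
...   | h′ , e′ , after≡ , refl , m′ with deletions-sound w m′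
...     | d , k , walk≡ = there x d , k , trans (walk-∷⁺ after≡) walk≡

∈-deletions-∷⁺ : ∀ {s h h′ x w e} → heightAfter x h ≡ just h′ → e ∈ deletions s h′ w →
  x ∷ e ∈ deletions s h (x ∷ w)
∈-deletions-∷⁺ {s} {h} {x = x} {w} after≡ m =
  ∈-++⁺ʳ (deleteHere s h x w) (∈-prepend⁺ {F = λ h′ → deletions s h′ w} after≡ m)

deletions-complete : ∀ {s h w e} → Deletion s w e → Walkable h e → e ∈ deletions s h w
deletions-complete {s} {h} {s ∷ w} here walkable with startsWith-view s w
... | inj₁ notStart = ∈-++⁺ˡ (∈-deleteHere⁺ walkable notStart)
... | inj₂ (w′ , refl) with walk-∷⁻ (proj₂ walkable)
...   | h′ , after≡ , walk≡ = ∈-deletions-∷⁺ {s} after≡ (deletions-complete {s} here (_ , walk≡))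
deletions-complete {s} (there x d) (k , walk≡) with walk-∷⁻ walk≡
... | h′ , after≡ , walk≡′ = ∈-deletions-∷⁺ {s} after≡ (deletions-complete {s} d (k , walk≡′))

deletions-unique : ∀ s h w → Unique (deletions s h w)
deletions-unique s h [] = []
deletions-unique s h (x ∷ w) =
  Unique.++⁺ (deleteHere-unique s h x w)
             (prepend-unique {x} {h} (λ h′ → deletions-unique s h′ w))
    (disjoint-prepend {x} {h} notStart)
  where
  notStart : ∀ {e} → e ∈ deleteHere s h x w → startsWith x e ≡ false
  notStart m with ∈-deleteHere⁻ {s} {h} {x} {w} m
  ... | refl , refl , _ , notStart = notStart

notStartingWith? : ∀ s e → Dec (startsWith s e ≡ false)
notStartingWith? s e = startsWith s e Bool.≟ false

dropStartingWith : Step → List Word → List Word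
dropStartingWith s = filter (notStartingWith? s)

dropStartingWith-prepend-self : ∀ x h F → dropStartingWith x (prepend x h F) ≡ []
dropStartingWith-prepend-self x h F = filter-none (notStartingWith? x) (tabulate λ m notStart →
  case trans (sym (startsWith-prepend {x} {h} {F} m)) notStart of λ ())

dropStartingWith-prepend-≢ : ∀ {x s} h F → x ≢ s →
  dropStartingWith s (prepend x h F) ≡ prepend x h F
dropStartingWith-prepend-≢ {x} h F x≢s =
  filter-all _ (tabulate (notStartsWith-prepend {x} {h} {F} x≢s))

-- Results starting with the head letter
-- are dropped: they also arise with the head kept, because its run continues or the two deleted
-- letters open a UDU (resp. DUD).
deletePairHere : ℕ → Step → Word → List Word
deletePairHere h U w = dropStartingWith U (deletions D h w)
deletePairHere h D w = dropStartingWith D (deletions U h w)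
deletePairHere h H w = []

pairDeletions : ℕ → Word → List Word
pairDeletions h [] = []
pairDeletions h (x ∷ w) = deletePairHere h x w ++ prepend x h (λ h′ → pairDeletions h′ w)

∈-deletePairHere⁻ : ∀ {h x w e} → e ∈ deletePairHere h x w →
  UDDeletion (x ∷ w) e × Walkable h e × startsWith x e ≡ false
∈-deletePairHere⁻ {h} {U} {w} m with ∈-filter⁻ (notStartingWith? U) {xs = deletions D h w} m
... | m′ , notStart = let d , walkable = deletions-sound w m′ in hereU d , walkable , notStart
∈-deletePairHere⁻ {h} {D} {w} m with ∈-filter⁻ (notStartingWith? D) {xs = deletions U h w} m
... | m′ , notStart = let d , walkable = deletions-sound w m′ in hereD d , walkable , notStart

pairDeletions-sound : ∀ {h} w {e} → e ∈ pairDeletions h w → UDDeletion w e × Walkable h e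
pairDeletions-sound {h} (x ∷ w) m with ∈-++⁻ (deletePairHere h x w) m
... | inj₁ m₁ = let d , walkable , _ = ∈-deletePairHere⁻ {h} {x} {w} m₁ in d , walkable
... | inj₂ m₂ with ∈-prepend⁻ {x} {h} m₂
...   | h′ , e′ , after≡ , refl , m′ with pairDeletions-sound w m′
...     | d , k , walk≡ = there x d , k , trans (walk-∷⁺ after≡) walk≡

∈-pairDeletions-∷⁺ : ∀ {h h′ x w e} → heightAfter x h ≡ just h′ →
  e ∈ pairDeletions h′ w →
  x ∷ e ∈ pairDeletions h (x ∷ w)
∈-pairDeletions-∷⁺ {h} {x = x} {w} after≡ m =
  ∈-++⁺ʳ (deletePairHere h x w) (∈-prepend⁺ {F = λ h′ → pairDeletions h′ w} after≡ m)

Deletion-D-U∷⇒UDDeletion : ∀ {w e} → Deletion D w (U ∷ e) → UDDeletion w e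
Deletion-D-U∷⇒UDDeletion here = hereD here
Deletion-D-U∷⇒UDDeletion (there U d) = hereU d

Deletion-U-D∷⇒UDDeletion : ∀ {w e} → Deletion U w (D ∷ e) → UDDeletion w e
Deletion-U-D∷⇒UDDeletion here = hereU here
Deletion-U-D∷⇒UDDeletion (there D d) = hereD d

pairDeletions-complete : ∀ {h w e} → UDDeletion w e → Walkable h e → e ∈ pairDeletions h w
pairDeletions-complete {h} {U ∷ w} {e} (hereU d) walkable with startsWith-view U e
... | inj₁ notStart =
  ∈-++⁺ˡ (∈-filter⁺ (notStartingWith? U) (deletions-complete d walkable) notStart)
... | inj₂ (e′ , refl) with walk-∷⁻ {U} {h} {e′} (proj₂ walkable)
...   | h′ , after≡ , walk≡ = ∈-pairDeletions-∷⁺ {x = U} {w} after≡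
                            (pairDeletions-complete (Deletion-D-U∷⇒UDDeletion d) (_ , walk≡))
pairDeletions-complete {h} {D ∷ w} {e} (hereD d) walkable with startsWith-view D e
... | inj₁ notStart =
  ∈-++⁺ˡ (∈-filter⁺ (notStartingWith? D) (deletions-complete d walkable) notStart)
... | inj₂ (e′ , refl) with walk-∷⁻ {D} {h} {e′} (proj₂ walkable)
...   | h′ , after≡ , walk≡ = ∈-pairDeletions-∷⁺ {x = D} {w} after≡
                            (pairDeletions-complete (Deletion-U-D∷⇒UDDeletion d) (_ , walk≡))
pairDeletions-complete {w = x ∷ w} (there x d) (k , walk≡) with walk-∷⁻ walk≡
... | h′ , after≡ , walk≡′ = ∈-pairDeletions-∷⁺ {x = x} {w} after≡ (pairDeletions-complete d (k , walk≡′))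

deletePairHere-unique : ∀ h x w → Unique (deletePairHere h x w)
deletePairHere-unique h U w = Unique.filter⁺ _ (deletions-unique D h w)
deletePairHere-unique h D w = Unique.filter⁺ _ (deletions-unique U h w)
deletePairHere-unique h H w = []

pairDeletions-unique : ∀ h w → Unique (pairDeletions h w)
pairDeletions-unique h [] = []
pairDeletions-unique h (x ∷ w) =
  Unique.++⁺ (deletePairHere-unique h x w)
             (prepend-unique {x} {h} (λ h′ → pairDeletions-unique h′ w))
    (disjoint-prepend {x} {h} (λ m → proj₂ (proj₂ (∈-deletePairHere⁻ {h} {x} {w} m))))

-- Counting the enumeration

-- From height h, the rest of the current factor and what follows it.
untilReturn : ℕ → Word → Word
untilReturn zero w = []
untilReturn (suc h) [] = []
untilReturn (suc h) (U ∷ w) = U ∷ untilReturn (suc (suc h)) w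
untilReturn (suc zero) (D ∷ w) = D ∷ []
untilReturn (suc (suc h)) (D ∷ w) = D ∷ untilReturn (suc h) w
untilReturn (suc h) (H ∷ w) = H ∷ untilReturn (suc h) w

afterReturn : ℕ → Word → Word
afterReturn zero w = w
afterReturn (suc h) [] = []
afterReturn (suc h) (U ∷ w) = afterReturn (suc (suc h)) w
afterReturn (suc zero) (D ∷ w) = w
afterReturn (suc (suc h)) (D ∷ w) = afterReturn (suc h) w
afterReturn (suc h) (H ∷ w) = afterReturn (suc h) w

startsWith-untilReturn : ∀ s h w → startsWith s (untilReturn (suc h) w) ≡ startsWith s w
startsWith-untilReturn s h [] = refl
startsWith-untilReturn s h (U ∷ w) = refl
startsWith-untilReturn s zero (D ∷ w) = refl
startsWith-untilReturn s (suc h) (D ∷ w) = refl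
startsWith-untilReturn s h (H ∷ w) = refl

length-singletonIf : ∀ b (w : Word) → length (if b then w ∷ [] else []) ≡ 𝟙 b
length-singletonIf true w = refl
length-singletonIf false w = refl

deleteHere-self : ∀ {s h w k} → walk h w ≡ just k →
  deleteHere s h s w ≡ (if not (startsWith s w) then w ∷ [] else [])
deleteHere-self {s} walk≡ rewrite ≟ₛ-refl s | walk≡ = refl

length-deletions-∷ : ∀ s h x w → length (deletions s h (x ∷ w)) ≡
  length (deleteHere s h x w) ℕ.+ maybe′ (λ h′ → length (deletions s h′ w)) 0 (heightAfter x h)
length-deletions-∷ s h x w with heightAfter x h
... | just h′ = trans (length-++ (deleteHere s h x w))
                      (cong (length (deleteHere s h x w) ℕ.+_) (length-map (x ∷_) (deletions s h′ w)))
... | nothing = length-++ (deleteHere s h x w)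

length-deleteHere-self : ∀ s h w {k} → walk h w ≡ just k →
  length (deleteHere s h s w) ≡ 𝟙 (not (startsWith s w))
length-deleteHere-self s h w walk≡ =
  trans (cong length (deleteHere-self {s} walk≡)) (length-singletonIf (not (startsWith s w)) w)

length-deletions-H : ∀ {h w k} → walk h w ≡ just k → length (deletions H h w) ≡ flats w
length-deletions-H {h} {[]} _ = refl
length-deletions-H {h} {U ∷ w} walk≡ =
  trans (length-deletions-∷ H h U w) (length-deletions-H {suc h} {w} walk≡)
length-deletions-H {suc h} {D ∷ w} walk≡ =
  trans (length-deletions-∷ H (suc h) D w) (length-deletions-H {h} {w} walk≡)
length-deletions-H {h} {H ∷ w} walk≡ = begin
  length (deletions H h (H ∷ w))                   ≡⟨ length-deletions-∷ H h H w ⟩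
  length (deleteHere H h H w) ℕ.+ length (deletions H h w)
    ≡⟨ cong₂ ℕ._+_ (length-deleteHere-self H h w walk≡)
                   (length-deletions-H {h} {w} walk≡) ⟩
  𝟙 (not (startsWith H w)) ℕ.+ flats w            ≡⟨ sym (runs-∷-self H w) ⟩
  flats (H ∷ w)                                    ∎
  where open ≡-Reasoning

length-deletions-U : ∀ {h w k} → walk h w ≡ just k → length (deletions U (suc h) w) ≡ ascents w
length-deletions-U {h} {[]} _ = refl
length-deletions-U {h} {U ∷ w} walk≡ = begin
  length (deletions U (suc h) (U ∷ w))             ≡⟨ length-deletions-∷ U (suc h) U w ⟩
  length (deleteHere U (suc h) U w) ℕ.+ length (deletions U (suc (suc h)) w)
    ≡⟨ cong₂ ℕ._+_ (length-deleteHere-self U (suc h) w walk≡)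
                   (length-deletions-U {suc h} {w} walk≡) ⟩
  𝟙 (not (startsWith U w)) ℕ.+ ascents w          ≡⟨ sym (runs-∷-self U w) ⟩
  ascents (U ∷ w)                                  ∎
  where open ≡-Reasoning
length-deletions-U {suc h} {D ∷ w} walk≡ =
  trans (length-deletions-∷ U (suc (suc h)) D w) (length-deletions-U {h} {w} walk≡)
length-deletions-U {h} {H ∷ w} walk≡ =
  trans (length-deletions-∷ U (suc h) H w) (length-deletions-U {h} {w} walk≡)

length-deletions-D : ∀ {h w} → walk (suc h) w ≡ just 0 →
  length (deletions D h w) ≡ descents (untilReturn (suc h) w)
length-deletions-D {h} {U ∷ w} walk≡ =
  trans (length-deletions-∷ D h U w) (length-deletions-D {suc h} {w} walk≡)
length-deletions-D {h} {H ∷ w} walk≡ =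
  trans (length-deletions-∷ D h H w) (length-deletions-D {h} {w} walk≡)
length-deletions-D {zero} {D ∷ w} walk≡ = begin
  length (deletions D 0 (D ∷ w))
    ≡⟨ length-deletions-∷ D 0 D w ⟩
  length (deleteHere D 0 D w) ℕ.+ 0
    ≡⟨ cong (ℕ._+ 0) (length-deleteHere-self D 0 w walk≡) ⟩
  𝟙 (not (startsWith D w)) ℕ.+ 0
    ≡⟨ cong (λ b → 𝟙 (not b) ℕ.+ 0) (walk-zero-startsWith-D {w} walk≡) ⟩
  descents (D ∷ []) ∎
  where open ≡-Reasoning
length-deletions-D {suc h} {D ∷ w} walk≡ = begin
  length (deletions D (suc h) (D ∷ w))             ≡⟨ length-deletions-∷ D (suc h) D w ⟩
  length (deleteHere D (suc h) D w) ℕ.+ length (deletions D h w)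
    ≡⟨ cong₂ ℕ._+_ (length-deleteHere-self D (suc h) w walk≡)
                   (length-deletions-D {h} {w} walk≡) ⟩
  𝟙 (not (startsWith D w)) ℕ.+ descents G
    ≡⟨ cong (λ b → 𝟙 (not b) ℕ.+ descents G) (sym (startsWith-untilReturn D h w)) ⟩
  𝟙 (not (startsWith D G)) ℕ.+ descents G
    ≡⟨ sym (runs-∷-self D G) ⟩
  descents (D ∷ G) ∎
  where
  open ≡-Reasoning
  G = untilReturn (suc h) w

length-dropStartingWith-singleton : ∀ s w →
  length (dropStartingWith s (w ∷ [])) ℕ.+ 𝟙 (startsWith s w) ≡ 1
length-dropStartingWith-singleton s w with startsWith-view s w
... | inj₁ notStart rewrite notStart = refl
... | inj₂ (w′ , refl) rewrite startsWith-∷ s w′ = refl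

length-dropStartingWith-deleteHere : ∀ {s t h w k} → t ≢ s → walk h w ≡ just k →
  length (dropStartingWith s (deleteHere t h t w)) ℕ.+ 𝟙 (startsWith s w) ≡
  length (deleteHere t h t w)
length-dropStartingWith-deleteHere {s} {t} {h} {w} t≢s walk≡
  rewrite deleteHere-self {t} {h} {w} walk≡ with startsWith-view t w
... | inj₁ notStart rewrite notStart = length-dropStartingWith-singleton s w
... | inj₂ (w′ , refl) rewrite startsWith-∷ t w′ | ≟ₛ-≢ t≢s = refl

length-dropStartingWith-deletions : ∀ {s t h w k} → t ≢ s → walk h w ≡ just k →
  length (dropStartingWith s (deletions t h (t ∷ w))) ℕ.+ 𝟙 (startsWith s w) ≡
  length (deletions t h (t ∷ w))
length-dropStartingWith-deletions {s} {t} {h} {w} t≢s walk≡ = begin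
  length (dropStartingWith s (atHead ++ later)) ℕ.+ 𝟙 (startsWith s w)
    ≡⟨ cong (λ l → length l ℕ.+ 𝟙 (startsWith s w)) (filter-++ _ atHead later) ⟩
  length (dropStartingWith s atHead ++ dropStartingWith s later) ℕ.+ 𝟙 (startsWith s w)
    ≡⟨ cong (λ l → length (dropStartingWith s atHead ++ l) ℕ.+ 𝟙 (startsWith s w))
         (dropStartingWith-prepend-≢ {t} {s} h (λ h′ → deletions t h′ w) t≢s) ⟩
  length (dropStartingWith s atHead ++ later) ℕ.+ 𝟙 (startsWith s w)
    ≡⟨ cong (ℕ._+ 𝟙 (startsWith s w)) (length-++ (dropStartingWith s atHead)) ⟩
  length (dropStartingWith s atHead) ℕ.+ length later ℕ.+ 𝟙 (startsWith s w)
    ≡⟨ xy∙z≈xz∙y (length (dropStartingWith s atHead)) (length later) _ ⟩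
  length (dropStartingWith s atHead) ℕ.+ 𝟙 (startsWith s w) ℕ.+ length later
    ≡⟨ cong (ℕ._+ length later) (length-dropStartingWith-deleteHere t≢s walk≡) ⟩
  length atHead ℕ.+ length later
    ≡⟨ sym (length-++ atHead) ⟩
  length (atHead ++ later) ∎
  where
  open ≡-Reasoning
  atHead = deleteHere t h t w
  later = prepend t h (λ h′ → deletions t h′ w)

-- A U ending its ascent pairs with each descent in the rest of its factor;
-- a D ending its descent pairs with every later ascent.
pairsAt : ℕ → Step → Word → ℕ
pairsAt h U w = 𝟙 (not (startsWith U w)) ℕ.* descents (untilReturn (suc h) w)
pairsAt h D w = 𝟙 (not (startsWith D w)) ℕ.* ascents w
pairsAt h H w = 0

pairCount : ℕ → Word → ℕ
pairCount h [] = 0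
pairCount h (x ∷ w) = pairsAt h x w ℕ.+ maybe′ (λ h′ → pairCount h′ w) 0 (heightAfter x h)

length-deletePairHere-U : ∀ {h w} → walk (suc h) w ≡ just 0 →
  length (deletePairHere h U w) ℕ.+ 𝟙 (isPrefix (D ∷ U ∷ []) w) ≡ pairsAt h U w
length-deletePairHere-U {h} {U ∷ w} _ =
  cong (λ l → length l ℕ.+ 0) (dropStartingWith-prepend-self U h (λ h′ → deletions D h′ w))
length-deletePairHere-U {h} {H ∷ w} walk≡ = begin
  length (dropStartingWith U (deletions D h (H ∷ w))) ℕ.+ 0
    ≡⟨ cong (λ l → length l ℕ.+ 0)
            (dropStartingWith-prepend-≢ {H} {U} h (λ h′ → deletions D h′ w) λ ()) ⟩
  length (deletions D h (H ∷ w)) ℕ.+ 0             ≡⟨ +-identityʳ _ ⟩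
  length (deletions D h (H ∷ w))                   ≡⟨ length-deletions-D {h} {H ∷ w} walk≡ ⟩
  descents (untilReturn (suc h) (H ∷ w))           ≡⟨ sym (*-identityˡ _) ⟩
  pairsAt h U (H ∷ w)                              ∎
  where open ≡-Reasoning
length-deletePairHere-U {h} {D ∷ w} walk≡ = begin
  length (dropStartingWith U (deletions D h (D ∷ w))) ℕ.+ 𝟙 (isPrefix (U ∷ []) w)
    ≡⟨ cong (λ b → length (dropStartingWith U (deletions D h (D ∷ w))) ℕ.+ 𝟙 b)
            (isPrefix-singleton U w) ⟩
  length (dropStartingWith U (deletions D h (D ∷ w))) ℕ.+ 𝟙 (startsWith U w)
    ≡⟨ length-dropStartingWith-deletions {U} {D} {h} {w} (λ ()) walk≡ ⟩
  length (deletions D h (D ∷ w))                   ≡⟨ length-deletions-D {h} {D ∷ w} walk≡ ⟩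
  descents (untilReturn (suc h) (D ∷ w))           ≡⟨ sym (*-identityˡ _) ⟩
  pairsAt h U (D ∷ w)                              ∎
  where open ≡-Reasoning

length-deletePairHere-D : ∀ {h w} → walk h w ≡ just 0 →
  length (deletePairHere (suc h) D w) ℕ.+ 𝟙 (isPrefix (U ∷ D ∷ []) w) ≡ pairsAt (suc h) D w
length-deletePairHere-D {h} {[]} _ = refl
length-deletePairHere-D {h} {D ∷ w} _ =
  cong (λ l → length l ℕ.+ 0)
       (dropStartingWith-prepend-self D (suc h) (λ h′ → deletions U h′ w))
length-deletePairHere-D {h} {H ∷ w} walk≡ = begin
  length (dropStartingWith D (deletions U (suc h) (H ∷ w))) ℕ.+ 0
    ≡⟨ cong (λ l → length l ℕ.+ 0)
            (dropStartingWith-prepend-≢ {H} {D} (suc h) (λ h′ → deletions U h′ w) λ ()) ⟩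
  length (deletions U (suc h) (H ∷ w)) ℕ.+ 0       ≡⟨ +-identityʳ _ ⟩
  length (deletions U (suc h) (H ∷ w))             ≡⟨ length-deletions-U {h} {H ∷ w} walk≡ ⟩
  ascents (H ∷ w)                                  ≡⟨ sym (*-identityˡ _) ⟩
  pairsAt (suc h) D (H ∷ w)                        ∎
  where open ≡-Reasoning
length-deletePairHere-D {h} {U ∷ w} walk≡ = begin
  length (dropStartingWith D (deletions U (suc h) (U ∷ w))) ℕ.+ 𝟙 (isPrefix (D ∷ []) w)
    ≡⟨ cong (λ b → length (dropStartingWith D (deletions U (suc h) (U ∷ w))) ℕ.+ 𝟙 b)
            (isPrefix-singleton D w) ⟩
  length (dropStartingWith D (deletions U (suc h) (U ∷ w))) ℕ.+ 𝟙 (startsWith D w)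
    ≡⟨ length-dropStartingWith-deletions {D} {U} {suc h} {w} (λ ()) walk≡ ⟩
  length (deletions U (suc h) (U ∷ w))             ≡⟨ length-deletions-U {h} {U ∷ w} walk≡ ⟩
  ascents (U ∷ w)                                  ≡⟨ sym (*-identityˡ _) ⟩
  pairsAt (suc h) D (U ∷ w)                        ∎
  where open ≡-Reasoning

length-deletePairHere : ∀ {h x w} → walk h (x ∷ w) ≡ just 0 →
  length (deletePairHere h x w) ℕ.+ 𝟙 (isPrefix (U ∷ D ∷ U ∷ []) (x ∷ w))
    ℕ.+ 𝟙 (isPrefix (D ∷ U ∷ D ∷ []) (x ∷ w)) ≡ pairsAt h x w
length-deletePairHere {h} {U} {w} walk≡ =
  trans (+-identityʳ _) (length-deletePairHere-U {h} {w} walk≡)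
length-deletePairHere {suc h} {D} {w} walk≡ =
  trans (cong (ℕ._+ 𝟙 (isPrefix (U ∷ D ∷ []) w)) (+-identityʳ _))
        (length-deletePairHere-D {h} {w} walk≡)
length-deletePairHere {h} {H} {w} _ = refl

length-pairDeletions : ∀ {h w} → walk h w ≡ just 0 →
  length (pairDeletions h w) ℕ.+ (pk w ℕ.+ vl w) ≡ pairCount h w
length-pairDeletions {h} {[]} _ = refl
length-pairDeletions {h} {x ∷ w} walk≡ with walk-∷⁻ {x} {h} {w} walk≡
... | h′ , after≡ , walk≡′ = begin
  length (atHead ++ later) ℕ.+ ((p ℕ.+ pk w) ℕ.+ (v ℕ.+ vl w))
    ≡⟨ cong (ℕ._+ ((p ℕ.+ pk w) ℕ.+ (v ℕ.+ vl w))) (length-++ atHead) ⟩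
  length atHead ℕ.+ length later ℕ.+ ((p ℕ.+ pk w) ℕ.+ (v ℕ.+ vl w))
    ≡⟨ cong (λ n → length atHead ℕ.+ n ℕ.+ ((p ℕ.+ pk w) ℕ.+ (v ℕ.+ vl w)))
         (length-prepend (λ h″ → pairDeletions h″ w) after≡) ⟩
  length atHead ℕ.+ length (pairDeletions h′ w) ℕ.+ ((p ℕ.+ pk w) ℕ.+ (v ℕ.+ vl w))
    ≡⟨ regroup (length atHead) (length (pairDeletions h′ w)) p (pk w) v (vl w) ⟩
  (length atHead ℕ.+ p ℕ.+ v) ℕ.+ (length (pairDeletions h′ w) ℕ.+ (pk w ℕ.+ vl w))
    ≡⟨ cong₂ ℕ._+_ (length-deletePairHere {h} {x} {w} walk≡)
                   (length-pairDeletions {h′} {w} walk≡′) ⟩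
  pairsAt h x w ℕ.+ pairCount h′ w
    ≡⟨ cong (λ m → pairsAt h x w ℕ.+ maybe′ (λ h″ → pairCount h″ w) 0 m) (sym after≡) ⟩
  pairCount h (x ∷ w) ∎
  where
  open ≡-Reasoning
  atHead = deletePairHere h x w
  later = prepend x h (λ h″ → pairDeletions h″ w)
  p = 𝟙 (isPrefix (U ∷ D ∷ U ∷ []) (x ∷ w))
  v = 𝟙 (isPrefix (D ∷ U ∷ D ∷ []) (x ∷ w))
  regroup : ∀ a l p q v r →
    a ℕ.+ l ℕ.+ (p ℕ.+ q ℕ.+ (v ℕ.+ r)) ≡ a ℕ.+ p ℕ.+ v ℕ.+ (l ℕ.+ (q ℕ.+ r))
  regroup = solve-∀

-- The pair count through the factorization

runsFrom-split : ∀ b h w → walk (suc h) w ≡ just 0 →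
  runsFrom b U w ≡ runsFrom b U (untilReturn (suc h) w) ℕ.+ ascents (afterReturn (suc h) w)
runsFrom-split b h (U ∷ w) walk≡ =
  trans (cong (newRun ℕ.+_) (runsFrom-split true (suc h) w walk≡)) (sym (+-assoc newRun _ _))
  where newRun = if b then 0 else 1
runsFrom-split b zero (D ∷ w) walk≡ = refl
runsFrom-split b (suc h) (D ∷ w) walk≡ = runsFrom-split false h w walk≡
runsFrom-split b h (H ∷ w) walk≡ = runsFrom-split false h w walk≡

reverse-∷-++ : ∀ (x : Step) xs ys → reverse (x ∷ xs) ++ ys ≡ reverse xs ++ x ∷ ys
reverse-∷-++ x xs ys =
  trans (cong (_++ ys) (unfold-reverse x xs)) (++-assoc (reverse xs) (x ∷ []) ys)

factorsFrom-return : ∀ h cur w → walk (suc h) w ≡ just 0 →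
  factorsFrom (suc h) cur w ≡
  (reverse cur ++ untilReturn (suc h) w) ∷ factors (afterReturn (suc h) w)
factorsFrom-return h cur (U ∷ w) walk≡ =
  trans (factorsFrom-return (suc h) (U ∷ cur) w walk≡) (cong (_∷ _) (reverse-∷-++ U cur _))
factorsFrom-return zero cur (D ∷ w) walk≡ = cong (_∷ factors w) (unfold-reverse D cur)
factorsFrom-return (suc h) cur (D ∷ w) walk≡ =
  trans (factorsFrom-return h (D ∷ cur) w walk≡) (cong (_∷ _) (reverse-∷-++ D cur _))
factorsFrom-return h cur (H ∷ w) walk≡ =
  trans (factorsFrom-return h (H ∷ cur) w walk≡) (cong (_∷ _) (reverse-∷-++ H cur _))

factors-U : ∀ w → walk 1 w ≡ just 0 →
  factors (U ∷ w) ≡ (U ∷ untilReturn 1 w) ∷ factors (afterReturn 1 w)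
factors-U w = factorsFrom-return 0 (U ∷ []) w

ascents-factors : ∀ h w → walk h w ≡ just 0 →
  sum (map ascents (factors (afterReturn h w))) ≡ ascents (afterReturn h w)
ascents-factors zero [] _ = refl
ascents-factors zero (U ∷ w) walk≡ = begin
  sum (map ascents (factors (U ∷ w)))
    ≡⟨ cong (λ fs → sum (map ascents fs)) (factors-U w walk≡) ⟩
  ascents (U ∷ G) ℕ.+ sum (map ascents (factors R))
    ≡⟨ cong (ascents (U ∷ G) ℕ.+_) (ascents-factors 1 w walk≡) ⟩
  suc (runsFrom true U G ℕ.+ ascents R)
    ≡⟨ cong suc (sym (runsFrom-split true 0 w walk≡)) ⟩
  ascents (U ∷ w) ∎
  where
  open ≡-Reasoning
  G = untilReturn 1 w
  R = afterReturn 1 w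
ascents-factors zero (H ∷ w) walk≡ = ascents-factors zero w walk≡
ascents-factors (suc h) (U ∷ w) walk≡ = ascents-factors (suc (suc h)) w walk≡
ascents-factors (suc zero) (D ∷ w) walk≡ = ascents-factors zero w walk≡
ascents-factors (suc (suc h)) (D ∷ w) walk≡ = ascents-factors (suc h) w walk≡
ascents-factors (suc h) (H ∷ w) walk≡ = ascents-factors (suc h) w walk≡

pairCount-split : ∀ h w → walk h w ≡ just 0 →
  pairCount h w ≡ ascents (untilReturn h w) ℕ.* descents (untilReturn h w)
                  ℕ.+ descents (untilReturn h w) ℕ.* ascents (afterReturn h w)
                  ℕ.+ sumDA (factors (afterReturn h w))
pairCount-split zero [] _ = refl
pairCount-split zero (H ∷ w) walk≡ = pairCount-split zero w walk≡
pairCount-split zero (U ∷ w) walk≡ = begin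
  𝟙 (not (startsWith U w)) ℕ.* dG ℕ.+ pairCount 1 w
    ≡⟨ cong₂ (λ b n → 𝟙 (not b) ℕ.* dG ℕ.+ n)
             (sym (startsWith-untilReturn U 0 w)) (pairCount-split 1 w walk≡) ⟩
  i ℕ.* dG ℕ.+ (aG ℕ.* dG ℕ.+ dG ℕ.* aR ℕ.+ S)
    ≡⟨ regroup i aG dG aR S ⟩
  dG ℕ.* ((i ℕ.+ aG) ℕ.+ aR) ℕ.+ S
    ≡⟨ cong₂ (λ a r → dG ℕ.* (a ℕ.+ r) ℕ.+ S)
             (sym (runs-∷-self U G)) (sym (ascents-factors 1 w walk≡)) ⟩
  sumDA ((U ∷ G) ∷ factors R)
    ≡⟨ cong sumDA (sym (factors-U w walk≡)) ⟩
  sumDA (factors (U ∷ w)) ∎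
  where
  open ≡-Reasoning
  G = untilReturn 1 w
  R = afterReturn 1 w
  i = 𝟙 (not (startsWith U G))
  aG = ascents G
  dG = descents G
  aR = ascents R
  S = sumDA (factors R)
  regroup : ∀ i a d r s → i ℕ.* d ℕ.+ (a ℕ.* d ℕ.+ d ℕ.* r ℕ.+ s) ≡ d ℕ.* ((i ℕ.+ a) ℕ.+ r) ℕ.+ s
  regroup = solve-∀
pairCount-split (suc h) (U ∷ w) walk≡ = begin
  𝟙 (not (startsWith U w)) ℕ.* dG ℕ.+ pairCount (suc (suc h)) w
    ≡⟨ cong₂ (λ b n → 𝟙 (not b) ℕ.* dG ℕ.+ n)
             (sym (startsWith-untilReturn U (suc h) w)) (pairCount-split (suc (suc h)) w walk≡) ⟩
  i ℕ.* dG ℕ.+ (aG ℕ.* dG ℕ.+ dG ℕ.* aR ℕ.+ S)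
    ≡⟨ regroup i aG dG aR S ⟩
  (i ℕ.+ aG) ℕ.* dG ℕ.+ dG ℕ.* aR ℕ.+ S
    ≡⟨ cong (λ a → a ℕ.* dG ℕ.+ dG ℕ.* aR ℕ.+ S) (sym (runs-∷-self U G)) ⟩
  ascents (U ∷ G) ℕ.* dG ℕ.+ dG ℕ.* aR ℕ.+ S ∎
  where
  open ≡-Reasoning
  G = untilReturn (suc (suc h)) w
  i = 𝟙 (not (startsWith U G))
  aG = ascents G
  dG = descents G
  aR = ascents (afterReturn (suc (suc h)) w)
  S = sumDA (factors (afterReturn (suc (suc h)) w))
  regroup : ∀ i a d r s → i ℕ.* d ℕ.+ (a ℕ.* d ℕ.+ d ℕ.* r ℕ.+ s) ≡ (i ℕ.+ a) ℕ.* d ℕ.+ d ℕ.* r ℕ.+ s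
  regroup = solve-∀
pairCount-split (suc h) (H ∷ w) walk≡ = pairCount-split (suc h) w walk≡
pairCount-split (suc zero) (D ∷ w) walk≡ =
  cong₂ (λ b n → 𝟙 (not b) ℕ.* ascents w ℕ.+ n)
        (walk-zero-startsWith-D {w} walk≡) (pairCount-split zero w walk≡)
pairCount-split (suc (suc h)) (D ∷ w) walk≡ = begin
  𝟙 (not (startsWith D w)) ℕ.* ascents w ℕ.+ pairCount (suc h) w
    ≡⟨ cong₂ (λ b n → 𝟙 (not b) ℕ.* ascents w ℕ.+ n)
             (sym (startsWith-untilReturn D h w)) (pairCount-split (suc h) w walk≡) ⟩
  i ℕ.* ascents w ℕ.+ (aG ℕ.* dG ℕ.+ dG ℕ.* aR ℕ.+ S)
    ≡⟨ cong (λ a → i ℕ.* a ℕ.+ (aG ℕ.* dG ℕ.+ dG ℕ.* aR ℕ.+ S)) (runsFrom-split false h w walk≡) ⟩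
  i ℕ.* (aG ℕ.+ aR) ℕ.+ (aG ℕ.* dG ℕ.+ dG ℕ.* aR ℕ.+ S)
    ≡⟨ regroup i aG dG aR S ⟩
  aG ℕ.* (i ℕ.+ dG) ℕ.+ (i ℕ.+ dG) ℕ.* aR ℕ.+ S
    ≡⟨ cong (λ d → aG ℕ.* d ℕ.+ d ℕ.* aR ℕ.+ S) (sym (runs-∷-self D G)) ⟩
  aG ℕ.* descents (D ∷ G) ℕ.+ descents (D ∷ G) ℕ.* aR ℕ.+ S ∎
  where
  open ≡-Reasoning
  G = untilReturn (suc h) w
  i = 𝟙 (not (startsWith D G))
  aG = ascents G
  dG = descents G
  aR = ascents (afterReturn (suc h) w)
  S = sumDA (factors (afterReturn (suc h) w))
  regroup : ∀ i a d r s →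
    i ℕ.* (a ℕ.+ r) ℕ.+ (a ℕ.* d ℕ.+ d ℕ.* r ℕ.+ s) ≡ a ℕ.* (i ℕ.+ d) ℕ.+ (i ℕ.+ d) ℕ.* r ℕ.+ s
  regroup = solve-∀

pairCount-factors : ∀ w → IsSchroder w → pairCount 0 w ≡ sumDA (factors w)
pairCount-factors w = pairCount-split 0 w

lowerCovers : Word → List Word
lowerCovers Q = deletions H 0 Q ++ pairDeletions 0 Q

∈-lowerCovers : ∀ {Q} → IsSchroder Q → ∀ P → P ∈ lowerCovers Q ⇔ P ⋖ Q
∈-lowerCovers {Q} sQ P = mk⇔ sound complete
  where
  sound : P ∈ lowerCovers Q → P ⋖ Q
  sound m with ∈-++⁻ (deletions H 0 Q) m
  ... | inj₁ m₁ = let d , walkable = deletions-sound Q m₁ in Deletion-H⇒⋖ sQ d walkable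
  ... | inj₂ m₂ = let d , walkable = pairDeletions-sound Q m₂ in UDDeletion⇒⋖ sQ d walkable
  complete : P ⋖ Q → P ∈ lowerCovers Q
  complete cover@(sP , _) with ⋖⇒deletion sQ cover
  ... | inj₁ d = ∈-++⁺ˡ (deletions-complete d (0 , sP))
  ... | inj₂ d = ∈-++⁺ʳ (deletions H 0 Q) (pairDeletions-complete d (0 , sP))

lowerCovers-unique : ∀ Q → Unique (lowerCovers Q)
lowerCovers-unique Q = Unique.++⁺ (deletions-unique H 0 Q) (pairDeletions-unique 0 Q) disjoint
  where
  disjoint : Disjoint (deletions H 0 Q) (pairDeletions 0 Q)
  disjoint (m₁ , m₂) = 1+n≢n (trans (sym (count-Deletion (proj₁ (deletions-sound Q m₁)) H))
                                    (count-UDDeletion (proj₁ (pairDeletions-sound Q m₂)) H))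

length-lowerCovers : ∀ Q → IsSchroder Q →
  length (lowerCovers Q) ℕ.+ (pk Q ℕ.+ vl Q) ≡ flats Q ℕ.+ sumDA (factors Q)
length-lowerCovers Q sQ = begin
  length (deletions H 0 Q ++ pairDeletions 0 Q) ℕ.+ (pk Q ℕ.+ vl Q)
    ≡⟨ cong (ℕ._+ (pk Q ℕ.+ vl Q)) (length-++ (deletions H 0 Q)) ⟩
  length (deletions H 0 Q) ℕ.+ length (pairDeletions 0 Q) ℕ.+ (pk Q ℕ.+ vl Q)
    ≡⟨ +-assoc (length (deletions H 0 Q)) _ _ ⟩
  length (deletions H 0 Q) ℕ.+ (length (pairDeletions 0 Q) ℕ.+ (pk Q ℕ.+ vl Q))
    ≡⟨ cong₂ ℕ._+_ (length-deletions-H {0} {Q} sQ)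
                   (trans (length-pairDeletions {0} {Q} sQ) (pairCount-factors Q sQ)) ⟩
  flats Q ℕ.+ sumDA (factors Q) ∎
  where open ≡-Reasoning

difference-form : ∀ {n p v f s} → n ℕ.+ (p ℕ.+ v) ≡ f ℕ.+ s → + n ≡ + s - + p - + v + + f
difference-form {n} {p} {v} {f} {s} eq = begin
  + n                                      ≡⟨ addSub (+ n) (+ p) (+ v) ⟩
  + n + (+ p + + v) - + p - + v            ≡⟨ cong (λ z → z - + p - + v) eqℤ ⟩
  + f + + s - + p - + v                    ≡⟨ moveLeft (+ f) (+ s) (+ p) (+ v) ⟩
  + s - + p - + v + + f                    ∎
  where
  open ≡-Reasoning
  eqℤ : + n + (+ p + + v) ≡ + f + + s
  eqℤ = begin
    + n + (+ p + + v)    ≡⟨ cong (λ z → + n + z) (sym (ℤ.pos-+ p v)) ⟩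
    + n + + (p ℕ.+ v)    ≡⟨ sym (ℤ.pos-+ n (p ℕ.+ v)) ⟩
    + (n ℕ.+ (p ℕ.+ v))  ≡⟨ cong +_ eq ⟩
    + (f ℕ.+ s)          ≡⟨ ℤ.pos-+ f s ⟩
    + f + + s            ∎
  addSub : ∀ a b c → a ≡ a + (b + c) - b - c
  addSub = ℤ-Solver.solve-∀
  moveLeft : ∀ a b c d → a + b - c - d ≡ b - c - d + a
  moveLeft = ℤ-Solver.solve-∀

mainTheorem1 : (Q : Word) → IsSchroder Q →
    Σ (List Word) λ L →
      Unique L ×
      ((P : Word) → (P ∈ L) ⇔ (IsSchroder P × P ≼ Q × suc (semilength P) ≡ semilength Q)) ×
      (+ length L ≡ + sumDA (factors Q) - + pk Q - + vl Q + + hf Q)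
mainTheorem1 Q sQ =
  lowerCovers Q , lowerCovers-unique Q , ∈-lowerCovers sQ ,
  difference-form {p = pk Q} {vl Q} {hf Q} (length-lowerCovers Q sQ)
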